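{- Let $z\in\mathbb{Z}[i]\setminus\{0\}$. (a) If $A$ is a $\mathrm{central}^*$ set in $(\mathbb{Z}[i],+)$, then $z^{ -1}A$ is also a $\mathrm{central}^*$ set. (b) If $A$ is a $C^*$-set in $(\mathbb{Z}[i],+)$, then $z^{ -1}A$ is also a $C^*$-set.
   Context: $\mathbb{Z}[i]$ is the ring of Gaussian integers; $z^{ -1}A=\{x\in\mathbb{Z}[i]: zx\in A\}$. $\beta\mathbb{Z}[i]$ is the set of ultrafilters on $\mathbb{Z}[i]$ with $A\in p+q$ iff $\{x:-x+A\in q\}\in p$ ($-x+A=\{y:x+y\in A\}$), a compact right topological semigroup with smallest ideal $K(\beta\mathbb{Z}[i])$. A set is $\mathrm{central}^*$ if it belongs to every idempotent of $K(\beta\mathbb{Z}[i])$. A set $A$ is a $J$-set if for every finite nonempty set $F$ of sequences $\mathbb{N}\to\mathbb{Z}[i]$ there exist $a\in\mathbb{Z}[i]$ and a finite nonempty $H\subseteq\mathbb{N}$ with $a+\sum_{t\in H}f(t)\in A$ for all $f\in F$; $J(\mathbb{Z}[i])$ is the set of $p\in\beta\mathbb{Z}[i]$ all of whose members are $J$-sets. A set is a $C^*$-set if it belongs to every idempotent of $\beta\mathbb{Z}[i]$ lying in $J(\mathbb{Z}[i])$. -}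

module Defs where

open import Data.Bool using (Bool; true; false; _∧_; not)
open import Data.Nat using (ℕ)
open import Data.Integer as ℤ using (ℤ)
open import Data.Product using (_×_; _,_; Σ; ∃; ∃-syntax)
open import Data.List using (List; []; _∷_; foldr)
open import Data.List.Relation.Unary.All using (All)
open import Data.List.Relation.Unary.Unique.Propositional using (Unique)
open import Relation.Binary.PropositionalEquality using (_≡_)

record Gauss : Set where
  constructor mkG
  field
    re : ℤ
    im : ℤ
open Gauss public

0G : Gauss
0G = mkG (ℤ.+ 0) (ℤ.+ 0)

infixl 6 _⊞_
infixl 7 _⊠_

_⊞_ : Gauss → Gauss → Gauss
mkG a b ⊞ mkG c d = mkG (a ℤ.+ c) (b ℤ.+ d)

_⊠_ : Gauss → Gauss → Gauss
mkG a b ⊠ mkG c d = mkG ((a ℤ.* c) ℤ.- (b ℤ.* d)) ((a ℤ.* d) ℤ.+ (b ℤ.* c))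

-- Subsets of ℤ[i] (classically every subset is decidable) and z⁻¹A

Subset : Set
Subset = Gauss → Bool

_⁻¹·_ : Gauss → Subset → Subset
(z ⁻¹· A) x = A (z ⊠ x)

shift : Gauss → Subset → Subset
shift x A y = A (x ⊞ y)

-- Ultrafilters on ℤ[i]: two-valued Boolean-algebra homomorphisms on
-- the power set (p A ≡ true means A ∈ p).

Filt : Set
Filt = Subset → Bool

record IsUltra (p : Filt) : Set where
  field
    ext   : ∀ A B → (∀ x → A x ≡ B x) → p A ≡ p B
    full  : p (λ _ → true) ≡ true
    meet  : ∀ A B → p (λ x → A x ∧ B x) ≡ p A ∧ p B
    compl : ∀ A → p (λ x → not (A x)) ≡ not (p A)

_≈_ : Filt → Filt → Set
p ≈ q = ∀ A → p A ≡ q A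

_⊕_ : Filt → Filt → Filt
(p ⊕ q) A = p (λ x → q (shift x A))

Idempotent : Filt → Set
Idempotent p = (p ⊕ p) ≈ p

record IsIdeal (I : Filt → Set) : Set₁ where
  field
    nonempty : ∃[ p ] (IsUltra p × I p)
    respects : ∀ p q → p ≈ q → I p → I q
    right    : ∀ p q → IsUltra p → IsUltra q → I p → I (p ⊕ q)
    left     : ∀ p q → IsUltra p → IsUltra q → I p → I (q ⊕ p)

-- membership in the smallest ideal K(βℤ[i]) = intersection of all ideals
InK : Filt → Set₁
InK p = ∀ (I : Filt → Set) → IsIdeal I → I p

CentralStar : Subset → Set₁
CentralStar A = ∀ p → IsUltra p → InK p → Idempotent p → p A ≡ true

sumOver : (ℕ → Gauss) → List ℕ → Gauss
sumOver f = foldr (λ t s → f t ⊞ s) 0G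

record FinNonemptyℕ : Set where
  constructor fin
  field
    hd     : ℕ
    tl     : List ℕ
    unique : Unique (hd ∷ tl)

elems : FinNonemptyℕ → List ℕ
elems (fin h t _) = h ∷ t

IsJSet : Subset → Set
IsJSet A =
  ∀ (f₀ : ℕ → Gauss) (Fs : List (ℕ → Gauss)) →
    ∃[ a ] ∃[ H ] All (λ f → A (a ⊞ sumOver f (elems H)) ≡ true) (f₀ ∷ Fs)

InJ : Filt → Set
InJ p = ∀ A → p A ≡ true → IsJSet A

CStar : Subset → Set
CStar A = ∀ p → IsUltra p → InJ p → Idempotent p → p A ≡ true

{-# OPTIONS --safe #-}
-- Multiplication by z extends to the pushforward x ↦ z x of ultrafilters,
-- an additive map, so it sends idempotents of βℤ[i] to idempotents and it
-- suffices that z p stays in K(βℤ[i]), resp. in J(ℤ[i]), whenever p does.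
-- For K: the preimage of an ideal is an ideal, and it is nonempty because
-- zℤ[i] ⊇ nℤ[i], n = |z|², has finite index, so every ultrafilter is a
-- translate of some z q.  For J: if z⁻¹B is a J-set so is B, since by
-- pigeonhole on the residues mod n of prefix sums any finitely many
-- sequences admit pairwise disjoint blocks whose sums all lie in nℤ[i] =
-- z · conj z · ℤ[i]; the J-property of z⁻¹B applied to the sequences of
-- block sums divided by z yields the witness for B.
module Submission where

open import Defs
open import Data.Bool using (true; false; _∧_; _∨_; not)
open import Data.Bool.Properties using (T-≡; ∧-conicalˡ; ∧-conicalʳ; ∧-identityʳ; ∧-zeroʳ)
open import Data.Nat as ℕ using (ℕ; zero; suc; NonZero; _≡ᵇ_; _<ᵇ_; _∸_; _^_)
import Data.Nat.Properties as ℕP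
open import Data.Nat.DivMod using (+-distrib-/-∣ˡ; m*n/n≡m; m<n⇒m/n≡0)
open import Data.Nat.Divisibility using (n∣m*n)
open import Data.Integer as ℤ using (ℤ; +_; -[1+_]; ∣_∣)
import Data.Integer.Properties as ℤP
open import Data.Integer.DivMod using (_%ℕ_; _/ℕ_; n%ℕd<d; a≡a%ℕn+[a/ℕn]*n)
open import Data.Integer.Tactic.RingSolver using (solve-∀)
open import Data.Fin using (Fin; toℕ; fromℕ<; combine)
open import Data.Fin.Properties using (pigeonhole; combine-injective; fromℕ<-injective; toℕ≤pred[n])
open import Data.List using (List; []; _∷_; _++_; map; concatMap; applyUpTo; length)
open import Data.List.Membership.Propositional using (_∈_)
open import Data.List.Membership.Propositional.Properties using (∈-applyUpTo⁻)
open import Data.List.Relation.Binary.Disjoint.Propositional using (Disjoint)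
open import Data.List.Relation.Unary.All as All using (All; []; _∷_)
import Data.List.Relation.Unary.All.Properties as AllP
import Data.List.Relation.Unary.AllPairs as AllPairs
import Data.List.Relation.Unary.AllPairs.Properties as AllPairsP
open import Data.List.Relation.Unary.Unique.Propositional.Properties using (concat⁺; applyUpTo⁺₁)
open import Data.Product using (_×_; _,_; ∃₂; ∃-syntax; proj₁; proj₂)
open import Data.Sum using (inj₁; inj₂)
open import Function using (_∘_; case_of_; Equivalence)
open import Relation.Binary.PropositionalEquality
open import Relation.Nullary using (¬_)

⊞-assoc : ∀ x y w → (x ⊞ y) ⊞ w ≡ x ⊞ (y ⊞ w)
⊞-assoc (mkG a b) (mkG c d) (mkG e f) = cong₂ mkG (ℤP.+-assoc a c e) (ℤP.+-assoc b d f)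

⊞-identityˡ : ∀ x → 0G ⊞ x ≡ x
⊞-identityˡ (mkG a b) = cong₂ mkG (ℤP.+-identityˡ a) (ℤP.+-identityˡ b)

⊠-zeroʳ : ∀ z → z ⊠ 0G ≡ 0G
⊠-zeroʳ (mkG a b) =
  cong₂ mkG (cong₂ ℤ._-_ (ℤP.*-zeroʳ a) (ℤP.*-zeroʳ b)) (cong₂ ℤ._+_ (ℤP.*-zeroʳ a) (ℤP.*-zeroʳ b))

⊠-distribˡ-⊞ : ∀ z x y → z ⊠ (x ⊞ y) ≡ z ⊠ x ⊞ z ⊠ y
⊠-distribˡ-⊞ (mkG a b) (mkG c d) (mkG e f) = cong₂ mkG (re-distrib a b c d e f) (im-distrib a b c d e f)
  where
  re-distrib : ∀ a b c d e f →
    a ℤ.* (c ℤ.+ e) ℤ.- b ℤ.* (d ℤ.+ f) ≡ (a ℤ.* c ℤ.- b ℤ.* d) ℤ.+ (a ℤ.* e ℤ.- b ℤ.* f)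
  re-distrib = solve-∀
  im-distrib : ∀ a b c d e f →
    a ℤ.* (d ℤ.+ f) ℤ.+ b ℤ.* (c ℤ.+ e) ≡ (a ℤ.* d ℤ.+ b ℤ.* c) ℤ.+ (a ℤ.* f ℤ.+ b ℤ.* e)
  im-distrib = solve-∀

conj : Gauss → Gauss
conj (mkG a b) = mkG a (ℤ.- b)

norm : Gauss → ℕ
norm (mkG a b) = ∣ a ∣ ℕ.* ∣ a ∣ ℕ.+ ∣ b ∣ ℕ.* ∣ b ∣

infixr 8 _·ᴳ_
_·ᴳ_ : ℤ → Gauss → Gauss
k ·ᴳ mkG a b = mkG (k ℤ.* a) (k ℤ.* b)

+∣i∣*∣i∣≡i*i : ∀ i → + (∣ i ∣ ℕ.* ∣ i ∣) ≡ i ℤ.* i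
+∣i∣*∣i∣≡i*i (+ m) = ℤP.pos-* m m
+∣i∣*∣i∣≡i*i -[1+ m ] = refl

+norm : ∀ a b → + norm (mkG a b) ≡ a ℤ.* a ℤ.+ b ℤ.* b
+norm a b = trans (ℤP.pos-+ (∣ a ∣ ℕ.* ∣ a ∣) _) (cong₂ ℤ._+_ (+∣i∣*∣i∣≡i*i a) (+∣i∣*∣i∣≡i*i b))

⊠-conj-⊠ : ∀ z y → z ⊠ (conj z ⊠ y) ≡ (+ norm z) ·ᴳ y
⊠-conj-⊠ (mkG a b) (mkG c d) =
  cong₂ mkG (trans (re-norm a b c d) (cong (ℤ._* c) (sym (+norm a b))))
            (trans (im-norm a b c d) (cong (ℤ._* d) (sym (+norm a b))))
  where
  re-norm : ∀ a b c d →
    a ℤ.* (a ℤ.* c ℤ.- ℤ.- b ℤ.* d) ℤ.- b ℤ.* (a ℤ.* d ℤ.+ ℤ.- b ℤ.* c) ≡ (a ℤ.* a ℤ.+ b ℤ.* b) ℤ.* c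
  re-norm = solve-∀
  im-norm : ∀ a b c d →
    a ℤ.* (a ℤ.* d ℤ.+ ℤ.- b ℤ.* c) ℤ.+ b ℤ.* (a ℤ.* c ℤ.- ℤ.- b ℤ.* d) ≡ (a ℤ.* a ℤ.+ b ℤ.* b) ℤ.* d
  im-norm = solve-∀

norm≡0⇒≡0G : ∀ z → norm z ≡ 0 → z ≡ 0G
norm≡0⇒≡0G (mkG a b) eq =
  cong₂ mkG (ℤP.∣i∣≡0⇒i≡0 (m*m≡0⇒m≡0 (ℕP.m+n≡0⇒m≡0 _ eq)))
            (ℤP.∣i∣≡0⇒i≡0 (m*m≡0⇒m≡0 (ℕP.m+n≡0⇒n≡0 (∣ a ∣ ℕ.* ∣ a ∣) eq)))
  where
  m*m≡0⇒m≡0 : ∀ {m} → m ℕ.* m ≡ 0 → m ≡ 0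
  m*m≡0⇒m≡0 {m} eq with ℕP.m*n≡0⇒m≡0∨n≡0 m eq
  ... | inj₁ m≡0 = m≡0
  ... | inj₂ m≡0 = m≡0

sumOver-++ : ∀ f xs ys → sumOver f (xs ++ ys) ≡ sumOver f xs ⊞ sumOver f ys
sumOver-++ f [] ys = sym (⊞-identityˡ _)
sumOver-++ f (x ∷ xs) ys =
  trans (cong (f x ⊞_) (sumOver-++ f xs ys)) (sym (⊞-assoc (f x) (sumOver f xs) (sumOver f ys)))

sumOver-concatMap : ∀ f (g : ℕ → List ℕ) hs →
  sumOver f (concatMap g hs) ≡ sumOver (λ m → sumOver f (g m)) hs
sumOver-concatMap f g [] = refl
sumOver-concatMap f g (h ∷ hs) =
  trans (sumOver-++ f (g h) _) (cong (sumOver f (g h) ⊞_) (sumOver-concatMap f g hs))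

sumOver-cong : ∀ {f g} → (∀ m → f m ≡ g m) → ∀ hs → sumOver f hs ≡ sumOver g hs
sumOver-cong f≗g [] = refl
sumOver-cong f≗g (h ∷ hs) = cong₂ _⊞_ (f≗g h) (sumOver-cong f≗g hs)

⊠-sumOver : ∀ z f hs → z ⊠ sumOver f hs ≡ sumOver (λ t → z ⊠ f t) hs
⊠-sumOver z f [] = ⊠-zeroʳ z
⊠-sumOver z f (t ∷ ts) = trans (⊠-distribˡ-⊞ z (f t) _) (cong (z ⊠ f t ⊞_) (⊠-sumOver z f ts))

applyUpTo-++ : ∀ {A : Set} (f : ℕ → A) i l →
  applyUpTo f (i ℕ.+ l) ≡ applyUpTo f i ++ applyUpTo (λ k → f (i ℕ.+ k)) l
applyUpTo-++ f zero l = refl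
applyUpTo-++ f (suc i) l = cong (f 0 ∷_) (applyUpTo-++ (f ∘ suc) i l)

-- Its list of elements reduces to concatMap (elems ∘ block) (elems H).
unionOfBlocks : (block : ℕ → FinNonemptyℕ) →
  (∀ {m m′} → m ≢ m′ → Disjoint (elems (block m)) (elems (block m′))) →
  (H : FinNonemptyℕ) → FinNonemptyℕ
unionOfBlocks block disjoint (fin h hs h∷hs!) = fin hd′ (tl′ ++ concatMap (elems ∘ block) hs)
  (concat⁺ (AllP.map⁺ (All.universal (FinNonemptyℕ.unique ∘ block) (h ∷ hs)))
           (AllPairsP.map⁺ (AllPairs.map disjoint h∷hs!)))
  where open FinNonemptyℕ (block h) renaming (hd to hd′; tl to tl′)

module Ultra {p : Filt} (u : IsUltra p) where
  open IsUltra u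

  ∅∉ : p (λ _ → false) ≡ false
  ∅∉ = trans (compl (λ _ → true)) (cong not full)

  ∪-prime : ∀ A B → p (λ x → A x ∨ B x) ≡ p A ∨ p B
  ∪-prime A B = begin
    p (λ x → A x ∨ B x)                   ≡⟨ ext _ _ (λ x → ∨≡not[not∧not] (A x) (B x)) ⟩
    p (λ x → not (not (A x) ∧ not (B x))) ≡⟨ compl _ ⟩
    not (p (λ x → not (A x) ∧ not (B x))) ≡⟨ cong not (meet _ _) ⟩
    not (p (not ∘ A) ∧ p (not ∘ B))       ≡⟨ cong₂ (λ a b → not (a ∧ b)) (compl A) (compl B) ⟩
    not (not (p A) ∧ not (p B))           ≡⟨ sym (∨≡not[not∧not] (p A) (p B)) ⟩
    p A ∨ p B                             ∎
    where
    open ≡-Reasoning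
    ∨≡not[not∧not] : ∀ a b → a ∨ b ≡ not (not a ∧ not b)
    ∨≡not[not∧not] true b = refl
    ∨≡not[not∧not] false true = refl
    ∨≡not[not∧not] false false = refl

  cong-on : ∀ {C} A B → p C ≡ true → (∀ x → C x ≡ true → A x ≡ B x) → p A ≡ p B
  cong-on {C} A B pC A≡B = begin
    p A                 ≡⟨ sym (∧-identityʳ (p A)) ⟩
    p A ∧ true          ≡⟨ cong (p A ∧_) (sym pC) ⟩
    p A ∧ p C           ≡⟨ sym (meet A C) ⟩
    p (λ x → A x ∧ C x) ≡⟨ ext _ _ pointwise ⟩
    p (λ x → B x ∧ C x) ≡⟨ meet B C ⟩
    p B ∧ p C           ≡⟨ cong (p B ∧_) pC ⟩
    p B ∧ true          ≡⟨ ∧-identityʳ (p B) ⟩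
    p B                 ∎
    where
    open ≡-Reasoning
    pointwise : ∀ x → (A x ∧ C x) ≡ (B x ∧ C x)
    pointwise x with C x in Cx
    ... | true = cong (_∧ true) (A≡B x Cx)
    ... | false = trans (∧-zeroʳ (A x)) (sym (∧-zeroʳ (B x)))

  fibre : ∀ M (g : Gauss → ℕ) → (∀ x → g x ℕ.< M) → ∃[ k ] p (λ x → g x ≡ᵇ k) ≡ true
  fibre M g g<M = search M (trans (ext _ _ (λ x → Equivalence.to T-≡ (ℕP.<⇒<ᵇ (g<M x)))) full)
    where
    <ᵇ-suc : ∀ m M → (m <ᵇ suc M) ≡ (m ≡ᵇ M) ∨ (m <ᵇ M)
    <ᵇ-suc zero zero = refl
    <ᵇ-suc zero (suc M) = refl
    <ᵇ-suc (suc m) zero = refl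
    <ᵇ-suc (suc m) (suc M) = <ᵇ-suc m M

    search : ∀ M → p (λ x → g x <ᵇ M) ≡ true → ∃[ k ] p (λ x → g x ≡ᵇ k) ≡ true
    search zero p∅ with () ← trans (sym ∅∉) p∅
    search (suc M) p<1+M with p (λ x → g x ≡ᵇ M) in p≡M
    ... | true = M , p≡M
    ... | false = search M (begin
      p (λ x → g x <ᵇ M)                      ≡⟨ cong (_∨ p (λ x → g x <ᵇ M)) (sym p≡M) ⟩
      p (λ x → g x ≡ᵇ M) ∨ p (λ x → g x <ᵇ M) ≡⟨ sym (∪-prime _ _) ⟩
      p (λ x → (g x ≡ᵇ M) ∨ (g x <ᵇ M))       ≡⟨ ext _ _ (λ x → sym (<ᵇ-suc (g x) M)) ⟩
      p (λ x → g x <ᵇ suc M)                  ≡⟨ p<1+M ⟩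
      true                                    ∎)
      where open ≡-Reasoning

principal : Gauss → Filt
principal t A = A t

principal-isUltra : ∀ t → IsUltra (principal t)
principal-isUltra t = record
  { ext = λ A B A≗B → A≗B t ; full = refl ; meet = λ _ _ → refl ; compl = λ _ → refl }

pushforward : (Gauss → Gauss) → Filt → Filt
pushforward f p A = p (A ∘ f)

pushforward-isUltra : ∀ f {p} → IsUltra p → IsUltra (pushforward f p)
pushforward-isUltra f u = record
  { ext = λ A B A≗B → ext _ _ (A≗B ∘ f)
  ; full = full
  ; meet = λ _ _ → meet _ _
  ; compl = λ _ → compl _
  }
  where open IsUltra u

pushforward-cong-on : ∀ {f g C p} → IsUltra p → p C ≡ true →
  (∀ x → C x ≡ true → f x ≡ g x) → pushforward f p ≈ pushforward g p
pushforward-cong-on u pC f≡g A = Ultra.cong-on u _ _ pC (λ x Cx → cong A (f≡g x Cx))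

TranslateSurjective : (Gauss → Gauss) → Set
TranslateSurjective f =
  ∀ r → IsUltra r → ∃₂ λ t q → IsUltra q × pushforward f q ≈ (principal t ⊕ r)

LiftsJSets : (Gauss → Gauss) → Set
LiftsJSets f = ∀ B → IsJSet (B ∘ f) → IsJSet B

module Additive (f : Gauss → Gauss) (f-hom : ∀ x y → f (x ⊞ y) ≡ f x ⊞ f y) where

  pushforward-⊕ : ∀ {p q} → IsUltra p → IsUltra q →
    pushforward f (p ⊕ q) ≈ (pushforward f p ⊕ pushforward f q)
  pushforward-⊕ up uq A = IsUltra.ext up _ _ (λ x → IsUltra.ext uq _ _ (λ y → cong A (f-hom x y)))

  pushforward-idempotent : ∀ {p} → IsUltra p → Idempotent p → Idempotent (pushforward f p)
  pushforward-idempotent up idem A = trans (sym (pushforward-⊕ up up A)) (idem (A ∘ f))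

  preimage-isIdeal : TranslateSurjective f → ∀ {I} → IsIdeal I → IsIdeal (I ∘ pushforward f)
  preimage-isIdeal surj {I} isI = record
    { nonempty = nonempty′
    ; respects = λ p q p≈q → respects _ _ (λ A → p≈q (A ∘ f))
    ; right = λ p q up uq → respects _ _ (λ A → sym (pushforward-⊕ up uq A))
                          ∘ right _ _ (pushforward-isUltra f up) (pushforward-isUltra f uq)
    ; left = λ p q up uq → respects _ _ (λ A → sym (pushforward-⊕ uq up A))
                         ∘ left _ _ (pushforward-isUltra f up) (pushforward-isUltra f uq)
    }
    where
    open IsIdeal isI
    nonempty′ : ∃[ q ] (IsUltra q × I (pushforward f q))
    nonempty′ with r , ur , Ir ← nonempty with t , q , uq , fq≈t+r ← surj r ur =
      q , uq , respects _ _ (λ A → sym (fq≈t+r A)) (left r (principal t) ur (principal-isUltra t) Ir)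

  InK-pushforward : TranslateSurjective f → ∀ {p} → InK p → InK (pushforward f p)
  InK-pushforward surj Kp I isI = Kp (I ∘ pushforward f) (preimage-isIdeal surj isI)

  InJ-pushforward : LiftsJSets f → ∀ {p} → InJ p → InJ (pushforward f p)
  InJ-pushforward lift Jp B fp∋B = lift B (Jp (B ∘ f) fp∋B)

  CentralStar-preimage : TranslateSurjective f → ∀ A → CentralStar A → CentralStar (A ∘ f)
  CentralStar-preimage surj A A* p up Kp idem =
    A* (pushforward f p) (pushforward-isUltra f up)
       (InK-pushforward surj Kp) (pushforward-idempotent up idem)

  CStar-preimage : LiftsJSets f → ∀ A → CStar A → CStar (A ∘ f)
  CStar-preimage lift A A* p up Jp idem =
    A* (pushforward f p) (pushforward-isUltra f up)
       (InJ-pushforward lift Jp) (pushforward-idempotent up idem)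

module Modulus (n : ℕ) .{{_ : NonZero n}} where

  quotient : Gauss → Gauss
  quotient x = mkG (re x /ℕ n) (im x /ℕ n)

  quotientGap : Gauss → Gauss → Gauss
  quotientGap x y = mkG (re y /ℕ n ℤ.- re x /ℕ n) (im y /ℕ n ℤ.- im x /ℕ n)

  residue : Gauss → Fin (n ℕ.* n)
  residue x = combine (fromℕ< (n%ℕd<d (re x) n)) (fromℕ< (n%ℕd<d (im x) n))

  n*[i/n]≡-c+i : ∀ i c → i %ℕ n ≡ c → + n ℤ.* (i /ℕ n) ≡ ℤ.- (+ c) ℤ.+ i
  n*[i/n]≡-c+i i c i%n≡c = begin
    + n ℤ.* (i /ℕ n)                                 ≡⟨ cancel (+ c) (i /ℕ n) (+ n) ⟩
    ℤ.- (+ c) ℤ.+ (+ c ℤ.+ (i /ℕ n) ℤ.* + n)         ≡⟨ cong (λ r → ℤ.- (+ c) ℤ.+ (+ r ℤ.+ (i /ℕ n) ℤ.* + n))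
                                                          (sym i%n≡c) ⟩
    ℤ.- (+ c) ℤ.+ (+ (i %ℕ n) ℤ.+ (i /ℕ n) ℤ.* + n)  ≡⟨ cong (λ j → ℤ.- (+ c) ℤ.+ j)
                                                          (sym (a≡a%ℕn+[a/ℕn]*n i n)) ⟩
    ℤ.- (+ c) ℤ.+ i                                  ∎
    where
    open ≡-Reasoning
    cancel : ∀ c q m → m ℤ.* q ≡ ℤ.- c ℤ.+ (c ℤ.+ q ℤ.* m)
    cancel = solve-∀

  %ℕ-cong⇒divisible : ∀ i s → i %ℕ n ≡ (i ℤ.+ s) %ℕ n →
    s ≡ + n ℤ.* ((i ℤ.+ s) /ℕ n ℤ.- i /ℕ n)
  %ℕ-cong⇒divisible i s i%n≡j%n = begin
    s                                        ≡⟨ difference i s ⟩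
    j ℤ.- i                                  ≡⟨ cong₂ ℤ._-_ (a≡a%ℕn+[a/ℕn]*n j n) (a≡a%ℕn+[a/ℕn]*n i n) ⟩
    (+ (j %ℕ n) ℤ.+ (j /ℕ n) ℤ.* + n) ℤ.- (+ (i %ℕ n) ℤ.+ (i /ℕ n) ℤ.* + n)
      ≡⟨ cong (λ r → (+ r ℤ.+ (j /ℕ n) ℤ.* + n) ℤ.- (+ (i %ℕ n) ℤ.+ (i /ℕ n) ℤ.* + n)) (sym i%n≡j%n) ⟩
    (+ (i %ℕ n) ℤ.+ (j /ℕ n) ℤ.* + n) ℤ.- (+ (i %ℕ n) ℤ.+ (i /ℕ n) ℤ.* + n)
      ≡⟨ factor (+ (i %ℕ n)) (i /ℕ n) (j /ℕ n) (+ n) ⟩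
    + n ℤ.* (j /ℕ n ℤ.- i /ℕ n)              ∎
    where
    open ≡-Reasoning
    j = i ℤ.+ s
    difference : ∀ i s → s ≡ (i ℤ.+ s) ℤ.- i
    difference = solve-∀
    factor : ∀ r q q′ m → (r ℤ.+ q′ ℤ.* m) ℤ.- (r ℤ.+ q ℤ.* m) ≡ m ℤ.* (q′ ℤ.- q)
    factor = solve-∀

  residue-cong⇒divisible : ∀ x y s → y ≡ x ⊞ s → residue x ≡ residue y →
    s ≡ (+ n) ·ᴳ quotientGap x y
  residue-cong⇒divisible x .(x ⊞ s) s refl eq
    with re≡ , im≡ ← combine-injective {m = n} {n = n} _ _ _ _ eq =
    cong₂ mkG (%ℕ-cong⇒divisible (re x) (re s) (fromℕ<-injective _ _ _ _ re≡))
              (%ℕ-cong⇒divisible (im x) (im s) (fromℕ<-injective _ _ _ _ im≡))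

  module Blocks (L : List (ℕ → Gauss)) where

    M : ℕ
    M = (n ℕ.* n) ^ length L

    instance
      M≢0 : NonZero M
      M≢0 = ℕP.m^n≢0 (n ℕ.* n) (length L) {{ℕP.m*n≢0 n n}}

    prefix : (ℕ → Gauss) → ℕ → ℕ → Gauss
    prefix f s j = sumOver f (applyUpTo (s ℕ.+_) j)

    prefix-split : ∀ f s i l →
      prefix f s (i ℕ.+ l) ≡ prefix f s i ⊞ sumOver f (applyUpTo (λ k → s ℕ.+ (i ℕ.+ k)) l)
    prefix-split f s i l =
      trans (cong (sumOver f) (applyUpTo-++ (s ℕ.+_) i l)) (sumOver-++ f (applyUpTo (s ℕ.+_) i) _)

    code : ∀ fs → ℕ → ℕ → Fin ((n ℕ.* n) ^ length fs)
    code [] s j = Fin.zero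
    code (f ∷ fs) s j = combine (residue (prefix f s j)) (code fs s j)

    code-injective : ∀ fs {s i j} → code fs s i ≡ code fs s j →
      All (λ f → residue (prefix f s i) ≡ residue (prefix f s j)) fs
    code-injective [] _ = []
    code-injective (f ∷ fs) eq with f≡ , fs≡ ← combine-injective _ _ _ _ eq = f≡ ∷ code-injective fs fs≡

    -- pigeonhole on the M + 1 prefixes of the window [s, s + M)
    collision : ∀ s → ∃₂ λ i l → i ℕ.+ suc l ℕ.≤ M × code L s i ≡ code L s (i ℕ.+ suc l)
    collision s with i , j , i<j , eq ← pigeonhole (ℕP.n<1+n M) (λ j → code L s (toℕ j)) =
      toℕ i , l , subst (ℕ._≤ M) (sym i+1+l≡j) (toℕ≤pred[n] j) , trans eq (cong (code L s) (sym i+1+l≡j))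
      where
      l = toℕ j ∸ suc (toℕ i)
      i+1+l≡j : toℕ i ℕ.+ suc l ≡ toℕ j
      i+1+l≡j = trans (ℕP.+-suc (toℕ i) l) (ℕP.m+[n∸m]≡n i<j)

    offset len : ℕ → ℕ
    offset m = proj₁ (collision (m ℕ.* M))
    len m = proj₁ (proj₂ (collision (m ℕ.* M)))

    segment-fits : ∀ m → offset m ℕ.+ suc (len m) ℕ.≤ M
    segment-fits m = proj₁ (proj₂ (proj₂ (collision (m ℕ.* M))))

    segment-codes : ∀ m → code L (m ℕ.* M) (offset m) ≡ code L (m ℕ.* M) (offset m ℕ.+ suc (len m))
    segment-codes m = proj₂ (proj₂ (proj₂ (collision (m ℕ.* M))))

    segment : ℕ → ℕ → ℕ
    segment m k = m ℕ.* M ℕ.+ (offset m ℕ.+ k)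

    block : ℕ → FinNonemptyℕ
    block m = fin (segment m 0) (applyUpTo (segment m ∘ suc) (len m))
      (applyUpTo⁺₁ (segment m) (suc (len m)) (λ i<j _ eq →
        ℕP.<⇒≢ i<j (ℕP.+-cancelˡ-≡ (offset m) _ _ (ℕP.+-cancelˡ-≡ (m ℕ.* M) _ _ eq))))

    block-window : ∀ m {v} → v ∈ elems (block m) → v ℕ./ M ≡ m
    block-window m v∈ with k , k<1+len , refl ← ∈-applyUpTo⁻ (segment m) v∈ = begin
      (m ℕ.* M ℕ.+ (offset m ℕ.+ k)) ℕ./ M      ≡⟨ +-distrib-/-∣ˡ (offset m ℕ.+ k) {M} (n∣m*n m) ⟩
      m ℕ.* M ℕ./ M ℕ.+ (offset m ℕ.+ k) ℕ./ M  ≡⟨ cong₂ ℕ._+_ (m*n/n≡m m M) (m<n⇒m/n≡0 offset+k<M) ⟩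
      m ℕ.+ 0                                 ≡⟨ ℕP.+-identityʳ m ⟩
      m                                       ∎
      where
      open ≡-Reasoning
      offset+k<M : offset m ℕ.+ k ℕ.< M
      offset+k<M = ℕP.<-≤-trans (ℕP.+-monoʳ-< (offset m) k<1+len) (segment-fits m)

    blocks-disjoint : ∀ {m m′} → m ≢ m′ → Disjoint (elems (block m)) (elems (block m′))
    blocks-disjoint {m} {m′} m≢m′ (v∈m , v∈m′) =
      m≢m′ (trans (sym (block-window m v∈m)) (block-window m′ v∈m′))

    blockQuotient : (ℕ → Gauss) → ℕ → Gauss
    blockQuotient f m =
      quotientGap (prefix f (m ℕ.* M) (offset m)) (prefix f (m ℕ.* M) (offset m ℕ.+ suc (len m)))

    sumOver-block : All (λ f → ∀ m → sumOver f (elems (block m)) ≡ (+ n) ·ᴳ blockQuotient f m) L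
    sumOver-block = All.tabulate λ {f} f∈L m →
      residue-cong⇒divisible (prefix f (m ℕ.* M) (offset m)) _ _
        (prefix-split f (m ℕ.* M) (offset m) (suc (len m)))
        (All.lookup (code-injective L (segment-codes m)) f∈L)

module Multiplication (z : Gauss) (z≢0 : ¬ z ≡ 0G) where

  n : ℕ
  n = norm z

  instance
    n≢0 : NonZero n
    n≢0 = ℕ.≢-nonZero (z≢0 ∘ norm≡0⇒≡0G z)

  open Modulus n

  -- Some member of r lies in one residue class (c , d) mod n, and there
  -- z ⊠ (conj z ⊠ quotient x) = n ·ᴳ quotient x = x - (c , d).
  ⊠-translateSurjective : TranslateSurjective (z ⊠_)
  ⊠-translateSurjective r ur =
    t , pushforward (λ x → conj z ⊠ quotient x) r , pushforward-isUltra _ ur ,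
    pushforward-cong-on ur rC onC
    where
    open IsUltra ur
    open Ultra ur
    residueClass : ∀ (part : Gauss → ℤ) → ∃[ c ] r (λ x → part x %ℕ n ≡ᵇ c) ≡ true
    residueClass part = fibre n (λ x → part x %ℕ n) (λ x → n%ℕd<d (part x) n)
    c = proj₁ (residueClass re)
    d = proj₁ (residueClass im)
    C : Subset
    C x = (re x %ℕ n ≡ᵇ c) ∧ (im x %ℕ n ≡ᵇ d)
    rC : r C ≡ true
    rC = trans (meet _ _) (cong₂ _∧_ (proj₂ (residueClass re)) (proj₂ (residueClass im)))
    t : Gauss
    t = mkG (ℤ.- (+ c)) (ℤ.- (+ d))
    ≡ᵇ-true⇒≡ : ∀ {m k} → (m ≡ᵇ k) ≡ true → m ≡ k
    ≡ᵇ-true⇒≡ {m} {k} eq = ℕP.≡ᵇ⇒≡ m k (Equivalence.from T-≡ eq)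
    onC : ∀ x → C x ≡ true → z ⊠ (conj z ⊠ quotient x) ≡ t ⊞ x
    onC x Cx = trans (⊠-conj-⊠ z (quotient x)) (cong₂ mkG
      (n*[i/n]≡-c+i (re x) c (≡ᵇ-true⇒≡ (∧-conicalˡ _ _ Cx)))
      (n*[i/n]≡-c+i (im x) d (≡ᵇ-true⇒≡ (∧-conicalʳ _ _ Cx))))

  ⊠-liftsJSets : LiftsJSets (z ⊠_)
  ⊠-liftsJSets B zB-J f₀ fs = case zB-J (lifted f₀) (map lifted fs) of λ where
      (a , H , zB∋) → z ⊠ a , unionOfBlocks block blocks-disjoint H ,
        All.zipWith (λ {f} (zB∋f , Σblock) → subst (λ y → B y ≡ true) (lift-sum {f} a H Σblock) zB∋f)
                    (AllP.map⁻ zB∋ , sumOver-block)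
    where
    open Blocks (f₀ ∷ fs)
    lifted : (ℕ → Gauss) → ℕ → Gauss
    lifted f m = conj z ⊠ blockQuotient f m
    lift-sum : ∀ {f} a H → (∀ m → sumOver f (elems (block m)) ≡ (+ n) ·ᴳ blockQuotient f m) →
      z ⊠ (a ⊞ sumOver (lifted f) (elems H))
        ≡ z ⊠ a ⊞ sumOver f (elems (unionOfBlocks block blocks-disjoint H))
    lift-sum {f} a H Σblock = begin
      z ⊠ (a ⊞ sumOver (lifted f) (elems H))
        ≡⟨ ⊠-distribˡ-⊞ z a _ ⟩
      z ⊠ a ⊞ z ⊠ sumOver (lifted f) (elems H)
        ≡⟨ cong (z ⊠ a ⊞_) (⊠-sumOver z (lifted f) (elems H)) ⟩
      z ⊠ a ⊞ sumOver (λ m → z ⊠ lifted f m) (elems H)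
        ≡⟨ cong (z ⊠ a ⊞_) (sumOver-cong (λ m → trans (⊠-conj-⊠ z _) (sym (Σblock m))) (elems H)) ⟩
      z ⊠ a ⊞ sumOver (λ m → sumOver f (elems (block m))) (elems H)
        ≡⟨ cong (z ⊠ a ⊞_) (sym (sumOver-concatMap f (elems ∘ block) (elems H))) ⟩
      z ⊠ a ⊞ sumOver f (concatMap (elems ∘ block) (elems H))
        ∎
      where open ≡-Reasoning

lemma2p19 : (z : Gauss) → ¬ (z ≡ 0G) →
    (∀ A → CentralStar A → CentralStar (z ⁻¹· A)) ×
    (∀ A → CStar A → CStar (z ⁻¹· A))
lemma2p19 z z≢0 = CentralStar-preimage ⊠-translateSurjective , CStar-preimage ⊠-liftsJSets
  where
  open Multiplication z z≢0
  open Additive (z ⊠_) (⊠-distribˡ-⊞ z)
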